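{- Let $\preceq_+\in\{\le_{\mathrm{lex}},\le_{\mathrm{pos}}\}$. For any pair $(p,\ell)\in[n]\times\mathbb{N}$, the following are equivalent: (a) $(p,\ell)\in\widetilde{\mathrm{GLPF}}$; (b) $\mathrm{GLPF}_{\preceq_+}[p]=\ell$ and $T_p[1..\ell]=T[p..p+\ell-1]$ is left-maximal in $T$; (c) there is $S\in CS_+$ with $p=\mathrm{pos}(S)$ such that, if $S$ is $(+)$-trivial then $\ell=0$, and if $S$ is $(+)$-nontrivial then $S=\mathrm{cano}_+(f)=\mathrm{repr}_-(w)\cdot X\cdot\mathrm{repr}_+(v)$ for some $(+)$-certificate $f=(w,X,v)\in ES_+$ and $\ell=|\mathrm{repr}_-(w)|$.
   Context: Let $T=T[1..n]$ be a text over an integer alphabet with total order, ending with a unique smallest end-marker $\$$. $T_p=T[p..n]$; for a suffix $S$, $\mathrm{pos}(S)=n+1-|S|$; $lcp(X,Y)$ is the longest-common-prefix length. $\le_{\mathrm{lex}}$ is lexicographic order; $X\le_{\mathrm{pos}}Y$ iff $|X|\ge|Y|$; $\prec$ denotes strict versions. $\mathrm{GLPF}_{\preceq_+}[p]=\max(\{lcp(T_p,T_q):T_q\prec_+T_p\}\cup\{0\})$. A factor $X$ of $T$ is left-maximal if it is a prefix of $T$ (in particular the empty string is left-maximal) or $aX$ and $bX$ both occur in $T$ for two distinct symbols $a\neq b$ (equivalently, no symbol can be prepended to $X$ without changing its set of end positions). The CDAWG $G$ of $T$ is the edge-labeled DAG obtained from the suffix tree of $T$ by merging isomorphic subtrees;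 it has a root and a sink, edges $f=(w,X,v)$ from $w$ to $v$ with nonempty label $X$, outgoing edges of a node start with distinct symbols, and spelling root-to-sink paths is a bijection onto the suffixes of $T$; $E$ is its edge set. For a node $v$, $N_-(v)$/$N_+(v)$ are incoming/outgoing edges, $U_-(v)$ the strings spelled by root-to-$v$ paths, $U_+(v)$ those spelled by $v$-to-sink paths. Let $\preceq_-=\le_{\mathrm{pos}}$ and $\mathrm{repr}_\delta(v)=\min_{\preceq_\delta}U_\delta(v)$ (strings identified with their unique paths). An edge of $N_-(v)$ is $(-)$-primary if it is the last edge of the path of $\mathrm{repr}_-(v)$; an edge of $N_+(v)$ is $(+)$-primary if it is the first edge of the path of $\mathrm{repr}_+(v)$; $EP_\delta$ = $\delta$-primary edges, $ES_\delta=E\setminus EP_\delta$. A suffix $S$ with path $(f_1,\dots,f_\ell)$ is $(+)$-trivial if all $f_i\in EP_+$; it has a $(+)$-canonical factoring at $k$ if $f_1,\dots,f_{k-1}\in EP_-$, $f_k\in ES_+$, $f_{k+1},\dots,f_\ell\in EP_+$, in which case $f_k$ is its $(+)$-certificate and $\mathrm{cano}_+(f_k)=S$. $CS_+$ is the set of $(+)$-canonical suffixes (the $(+)$-trivial one and those with a $(+)$-canonical factoring). $\widetilde{\mathrm{GLPF}}=\{(\mathrm{pos}(S),\mathrm{GLPF}_{\preceq_+}[\mathrm{pos}(S)]):S\in CS_+\}$. -}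

module Defs where

open import Data.Nat using (ℕ; zero; suc; _+_; _∸_; _≤_; _<_; _≟_)
open import Data.List using (List; []; _∷_; _++_; length; concatMap; drop; take)
open import Data.List.Relation.Unary.All using (All)
open import Data.List.Relation.Binary.Lex.Core using (Lex-<; Lex-≤)
open import Data.Product using (Σ; ∃; ∃-syntax; _×_; _,_; proj₁; proj₂)
open import Data.Sum using (_⊎_)
open import Relation.Binary.PropositionalEquality using (_≡_; _≢_)
open import Relation.Nullary using (¬_; yes; no)

Str : Set
Str = List ℕ

data Order : Set where
  lexO posO : Order

_≤pos_ : Str → Str → Set
X ≤pos Y = length Y ≤ length X

_<pos_ : Str → Str → Set
X <pos Y = length Y < length X

_≤lex_ : Str → Str → Set
_≤lex_ = Lex-≤ _≡_ _<_

_<lex_ : Str → Str → Set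
_<lex_ = Lex-< _≡_ _<_

_⊑⟨_⟩_ : Str → Order → Str → Set
X ⊑⟨ lexO ⟩ Y = X ≤lex Y
X ⊑⟨ posO ⟩ Y = X ≤pos Y

_⊏⟨_⟩_ : Str → Order → Str → Set
X ⊏⟨ lexO ⟩ Y = X <lex Y
X ⊏⟨ posO ⟩ Y = X <pos Y

lcp : Str → Str → ℕ
lcp (x ∷ xs) (y ∷ ys) with x ≟ y
... | yes _ = suc (lcp xs ys)
... | no _  = 0
lcp _ _ = 0

EndMarked : Str → Set
EndMarked T = ∃[ T′ ] ∃[ d ] (T ≡ T′ ++ (d ∷ []) × All (d <_) T′)

module Text (T : Str) where

  n : ℕ
  n = length T

  -- T_p = T[p..n]  (1-based)
  Suf : ℕ → Str
  Suf p = drop (p ∸ 1) T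

  pos : Str → ℕ
  pos S = suc n ∸ length S

  -- GLPF_{⪯₊}[p] = ℓ : ℓ is the maximum of {lcp(T_p,T_q) : T_q ≺₊ T_p} ∪ {0}
  IsGLPF : Order → ℕ → ℕ → Set
  IsGLPF o p ℓ =
    (∀ q → 1 ≤ q → q ≤ n → Suf q ⊏⟨ o ⟩ Suf p → lcp (Suf p) (Suf q) ≤ ℓ)
    × (ℓ ≡ 0 ⊎ ∃[ q ] (1 ≤ q × q ≤ n × Suf q ⊏⟨ o ⟩ Suf p × lcp (Suf p) (Suf q) ≡ ℓ))

  Factor : Str → Set
  Factor X = ∃[ u ] ∃[ w ] (T ≡ u ++ X ++ w)

  IsSuffix : Str → Set
  IsSuffix X = ∃[ u ] (T ≡ u ++ X)

  IsPrefix : Str → Set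
  IsPrefix X = ∃[ w ] (T ≡ X ++ w)

  EndsAt : Str → ℕ → Set
  EndsAt X j = ∃[ u ] ∃[ w ] (T ≡ u ++ X ++ w × length (u ++ X) ≡ j)

  SameEndPos : Str → Str → Set
  SameEndPos X Y = ∀ j → (EndsAt X j → EndsAt Y j) × (EndsAt Y j → EndsAt X j)

  LeftMax : Str → Set
  LeftMax X = IsPrefix X ⊎ ∃[ a ] ∃[ b ] (a ≢ b × Factor (a ∷ X) × Factor (b ∷ X))

  RightMax : Str → Set
  RightMax X = ∃[ a ] ∃[ b ] (a ≢ b × Factor (X ++ a ∷ []) × Factor (X ++ b ∷ []))

  -- strings spelled by (explicit) nodes of the suffix tree of T:
  -- branching (right-maximal) nodes, the root (ε) and the leaves (suffixes)
  STNode : Str → Set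
  STNode X = RightMax X ⊎ IsSuffix X

  -- Merging isomorphic subtrees of the suffix tree
  -- identifies suffix-tree nodes with equal end-position sets; a CDAWG
  -- node is identified with the longest string of its class, i.e. the
  -- unique left-maximal one.

  Node : Str → Set
  Node x = STNode x × LeftMax x

  root sink : Str
  root = []
  sink = T

  Edge : Set
  Edge = Str × Str × Str

  src lab tgt : Edge → Str
  src (w , X , v) = w
  lab (w , X , v) = X
  tgt (w , X , v) = v

  -- (w , X , v) ∈ E : w X is the suffix-tree child of w reached by X,
  -- and v is the CDAWG node whose class contains w X.
  IsEdge : Edge → Set
  IsEdge (w , X , v) =
    Node w × X ≢ [] × STNode (w ++ X)
    × (∀ X₁ X₂ → X ≡ X₁ ++ X₂ → X₁ ≢ [] → X₂ ≢ [] → ¬ STNode (w ++ X₁))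
    × Node v × (∃[ u ] (v ≡ u ++ (w ++ X))) × SameEndPos (w ++ X) v

  data Path : Str → Str → List Edge → Set where
    nil  : ∀ {a} → Path a a []
    cons : ∀ {w X v b P} → IsEdge (w , X , v) → Path v b P → Path w b ((w , X , v) ∷ P)

  spell : List Edge → Str
  spell = concatMap lab

  IsReprMinus : Str → List Edge → Set
  IsReprMinus v P = Path root v P × (∀ Q → Path root v Q → spell P ≤pos spell Q)

  IsReprPlus : Order → Str → List Edge → Set
  IsReprPlus o v P = Path v sink P × (∀ Q → Path v sink Q → spell P ⊑⟨ o ⟩ spell Q)

  PrimMinus : Edge → Set
  PrimMinus f = ∃[ P ] (IsReprMinus (tgt f) P × ∃[ P′ ] (P ≡ P′ ++ (f ∷ [])))

  PrimPlus : Order → Edge → Set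
  PrimPlus o f = ∃[ P ] (IsReprPlus o (src f) P × ∃[ P′ ] (P ≡ f ∷ P′))

  Secondary : Order → Edge → Set
  Secondary o f = IsEdge f × ¬ PrimPlus o f

  -- suffixes are identified with their root-to-sink paths
  SuffixPath : List Edge → Set
  SuffixPath S = Path root sink S

  Trivial : Order → List Edge → Set
  Trivial o S = All (PrimPlus o) S

  CanoCert : Order → List Edge → Edge → Set
  CanoCert o S f = ∃[ A ] ∃[ B ]
    (S ≡ A ++ f ∷ B × All PrimMinus A × Secondary o f × All (PrimPlus o) B)

  Canonical : Order → List Edge → Set
  Canonical o S = SuffixPath S × (Trivial o S ⊎ ∃[ f ] CanoCert o S f)

  InGLPF~ : Order → ℕ → ℕ → Set
  InGLPF~ o p ℓ = ∃[ S ] (Canonical o S × pos (spell S) ≡ p × IsGLPF o (pos (spell S)) ℓ)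

-- Every suffix of T is spelled by exactly one root-to-sink path of the CDAWG.  If all its edges are
-- (+)-primary it spells the ⪯₊-least suffix, so GLPF is 0.  Otherwise let f = (w, X, v) be its
-- certificate: the (−)-primary edges before f spell w itself and the edges after f spell repr₊(v).
-- No suffix-tree node lies strictly inside an edge, so a suffix sharing more than |w| symbols with
-- w·X·repr₊(v) continues through f and is therefore not smaller; and because f is not (+)-primary,
-- some smaller suffix does start with w.  Hence GLPF = |w|, and w, a CDAWG node, is left-maximal.
-- Conversely, if GLPF[p] = ℓ and W = T_p[1..ℓ] is left-maximal, then W is also a suffix-tree node
-- (T_p and a GLPF witness part after W), hence a CDAWG node.  Spelling T_p as W, then the edge
-- leaving W along T_p, then a path to the sink, the GLPF bound forces that path to be repr₊ and
-- that edge to be (+)-secondary, which is a (+)-canonical factoring with ℓ = |repr₋(W)|.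

module Submission where

open import Defs
open import Data.Nat using (ℕ; _≤_)
open import Data.List using (List; []; _∷_; _++_; length; take)
open import Data.Product using (Σ; ∃; ∃-syntax; _×_; _,_)
open import Relation.Binary.PropositionalEquality using (_≡_)
open import Relation.Nullary using (¬_)
open import Function.Bundles using (_⇔_)

open import Data.Empty using (⊥; ⊥-elim)
open import Data.List using (drop; _∷ʳ_; initLast; _∷ʳ′_)
open import Data.List.Membership.Propositional using (_∈_; find; lose)
open import Data.List.Membership.Propositional.Properties using (∈-++⁺ˡ; ∈-++⁺ʳ)
open import Data.List.Properties
  using ( ++-assoc; ++-identityʳ; ++-cancelʳ; ∷-injective; ∷ʳ-injective; ∷ʳ-injectiveˡ; ∷ʳ-injectiveʳ; ∷ʳ-++
        ; length-++; length-++-≤ˡ; length-++-≤ʳ; length-drop; length-take; take++drop≡id; take-all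
        ; concatMap-++; ≡-dec)
open import Data.List.Relation.Binary.Lex.Core using (base; halt; this; next)
open import Data.List.Relation.Binary.Lex.Strict using (<-decidable; <-transitive; ≤-transitive)
open import Data.List.Relation.Unary.All using (All; []; _∷_; lookup)
open import Data.List.Relation.Unary.All.Properties using (++⁻ʳ)
open import Data.List.Relation.Unary.Any using (here; any?)
open import Data.Nat using (zero; suc; pred; _+_; _∸_; _<_; _≟_; z≤n; s≤s; _≤?_; _<?_)
open import Data.Nat.Induction using (<-wellFounded)
open import Data.Nat.Properties
open import Data.Product using (proj₁; proj₂)
open import Data.Sum using (_⊎_; inj₁; inj₂)
open import Data.Unit using (tt)
open import Function using (_∘′_)
open import Function.Bundles using (mk⇔)
open import Induction.WellFounded using (Acc; acc)
open import Relation.Binary.Definitions using (tri<; tri≈; tri>)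
open import Relation.Binary.PropositionalEquality
  using (_≢_; refl; sym; trans; cong; cong₂; subst; subst₂; isEquivalence; module ≡-Reasoning)
open import Relation.Nullary using (Dec; yes; no; ¬?; _×-dec_; _⊎-dec_)

module _ {ℓ} {A : Set ℓ} where

  ++-equidivisible : ∀ (a c : List A) {b d : List A} → a ++ b ≡ c ++ d →
    (∃[ z ] (c ≡ a ++ z × b ≡ z ++ d)) ⊎ (∃[ z ] (a ≡ c ++ z × d ≡ z ++ b))
  ++-equidivisible []      c       eq = inj₁ (c , refl , eq)
  ++-equidivisible (x ∷ a) []      eq = inj₂ (x ∷ a , refl , sym eq)
  ++-equidivisible (x ∷ a) (y ∷ c) eq with ∷-injective eq
  ... | refl , eq′ with ++-equidivisible a c eq′
  ... | inj₁ (z , e₁ , e₂) = inj₁ (z , cong (x ∷_) e₁ , e₂)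
  ... | inj₂ (z , e₁ , e₂) = inj₂ (z , cong (x ∷_) e₁ , e₂)

  ++-cancel-length : ∀ (a c : List A) {b d : List A} → a ++ b ≡ c ++ d → length a ≡ length c → a ≡ c × b ≡ d
  ++-cancel-length []      []      eq _ = refl , eq
  ++-cancel-length (x ∷ a) (y ∷ c) eq len with ∷-injective eq
  ... | refl , eq′ with ++-cancel-length a c eq′ (cong pred len)
  ... | refl , e = refl , e

  ++-nonemptyʳ : ∀ (a b : List A) → b ≢ [] → a ++ b ≢ []
  ++-nonemptyʳ []      b b≢[] = b≢[]
  ++-nonemptyʳ (x ∷ a) b _    ()

  ++-nonemptyˡ : ∀ (a b : List A) → a ≢ [] → a ++ b ≢ []
  ++-nonemptyˡ []      b a≢[] = ⊥-elim (a≢[] refl)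
  ++-nonemptyˡ (x ∷ a) b _    ()

  length-++-nonempty : ∀ (a b : List A) → b ≢ [] → length a < length (a ++ b)
  length-++-nonempty []      []      b≢[] = ⊥-elim (b≢[] refl)
  length-++-nonempty []      (_ ∷ _) _    = s≤s z≤n
  length-++-nonempty (x ∷ a) b       b≢[] = s≤s (length-++-nonempty a b b≢[])

  length-nonempty : ∀ {X : List A} → X ≢ [] → 1 ≤ length X
  length-nonempty {[]}    X≢[] = ⊥-elim (X≢[] refl)
  length-nonempty {_ ∷ _} _    = s≤s z≤n

  length-nonempty-++ : ∀ (X R : List A) → X ≢ [] → length R < length (X ++ R)
  length-nonempty-++ []      R X≢[] = ⊥-elim (X≢[] refl)
  length-nonempty-++ (x ∷ X) R _    = s≤s (length-++-≤ʳ R {X})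

  suffix-≡-by-length : ∀ u {Y Z : List A} → Z ≡ u ++ Y → length Z ≤ length Y → Z ≡ Y
  suffix-≡-by-length []      Z≡Y _     = Z≡Y
  suffix-≡-by-length (x ∷ u) {Y} refl |Z|≤|Y| = ⊥-elim (≤⇒≯ |Z|≤|Y| (s≤s (length-++-≤ʳ Y {u})))

  take-length-++ : ∀ (w X : List A) → take (length w) (w ++ X) ≡ w
  take-length-++ []      X = refl
  take-length-++ (x ∷ w) X = cong (x ∷_) (take-length-++ w X)

  drop-length-++ : ∀ (w X : List A) → drop (length w) (w ++ X) ≡ X
  drop-length-++ []      X = refl
  drop-length-++ (x ∷ w) X = drop-length-++ w X

  beyond-prefix : ∀ (w P : List A) {X Z} → w ++ X ≡ P ++ Z → length w < length P →
    ∃[ z ] (z ≢ [] × P ≡ w ++ z × X ≡ z ++ Z)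
  beyond-prefix w P eq |w|<|P| with ++-equidivisible w P eq
  ... | inj₁ (z , P≡wz , X≡zZ) = z , z≢[] , P≡wz , X≡zZ
    where
    z≢[] : z ≢ []
    z≢[] refl = <-irrefl (cong length (sym (trans P≡wz (++-identityʳ w)))) |w|<|P|
  ... | inj₂ (z , w≡Pz , _) =
    ⊥-elim (≤⇒≯ (subst (length P ≤_) (cong length (sym w≡Pz)) (length-++-≤ˡ P)) |w|<|P|)

prefix? : ∀ (X L : Str) → Dec (∃[ w ] (L ≡ X ++ w))
prefix? X L with ≡-dec _≟_ (take (length X) L) X
... | yes e = yes (drop (length X) L , trans (sym (take++drop≡id (length X) L)) (cong (_++ drop (length X) L) e))
... | no ne = no λ { (w , refl) → ne (take-length-++ X w) }

prefix-trichotomy : ∀ (X Y : Str) →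
  (∃[ Z ] (Y ≡ X ++ Z))
  ⊎ (∃[ Z ] (Z ≢ [] × X ≡ Y ++ Z))
  ⊎ (∃[ P ] ∃[ a ] ∃[ b ] ∃[ Z ] ∃[ Z′ ] (a ≢ b × X ≡ P ++ a ∷ Z × Y ≡ P ++ b ∷ Z′))
prefix-trichotomy []      Y       = inj₁ (Y , refl)
prefix-trichotomy (x ∷ X) []      = inj₂ (inj₁ (x ∷ X , (λ ()) , refl))
prefix-trichotomy (x ∷ X) (y ∷ Y) with x ≟ y
... | no x≢y = inj₂ (inj₂ ([] , x , y , X , Y , x≢y , refl , refl))
... | yes refl with prefix-trichotomy X Y
... | inj₁ (Z , e) = inj₁ (Z , cong (x ∷_) e)
... | inj₂ (inj₁ (Z , Z≢[] , e)) = inj₂ (inj₁ (Z , Z≢[] , cong (x ∷_) e))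
... | inj₂ (inj₂ (P , a , b , Z , Z′ , a≢b , e₁ , e₂)) =
  inj₂ (inj₂ (x ∷ P , a , b , Z , Z′ , a≢b , cong (x ∷_) e₁ , cong (x ∷_) e₂))

least : ∀ {P : ℕ → Set} → (∀ k → Dec (P k)) → ∀ {m} → P m →
  ∃[ k ] (P k × k ≤ m × (∀ {j} → j < k → ¬ P j))
least {P} P? {m} = go (<-wellFounded m)
  where
  go : ∀ {m} → Acc _<_ m → P m → ∃[ k ] (P k × k ≤ m × (∀ {j} → j < k → ¬ P j))
  go {m} (acc smaller) pm with anyUpTo? P? m
  ... | no none = m , pm , ≤-refl , λ j<m pj → none (_ , j<m , pj)
  ... | yes (j , j<m , pj) with go (smaller j<m) pj
  ... | k , pk , k≤j , below = k , pk , ≤-trans k≤j (<⇒≤ j<m) , below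

lcp-++ : ∀ (w X Y : Str) → lcp (w ++ X) (w ++ Y) ≡ length w + lcp X Y
lcp-++ []      X Y = refl
lcp-++ (x ∷ w) X Y with x ≟ x
... | yes _  = cong suc (lcp-++ w X Y)
... | no x≢x = ⊥-elim (x≢x refl)

lcp-≢ : ∀ {a b} (Z Z′ : Str) → a ≢ b → lcp (a ∷ Z) (b ∷ Z′) ≡ 0
lcp-≢ {a} {b} Z Z′ a≢b with a ≟ b
... | yes a≡b = ⊥-elim (a≢b a≡b)
... | no _    = refl

lcp-[]ʳ : ∀ (X : Str) → lcp X [] ≡ 0
lcp-[]ʳ []      = refl
lcp-[]ʳ (x ∷ X) = refl

lcp-common-prefix : ∀ (w X Y : Str) → length w ≤ lcp (w ++ X) (w ++ Y)
lcp-common-prefix w X Y = subst (length w ≤_) (sym (lcp-++ w X Y)) (m≤m+n _ _)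

lcp-prefix : ∀ (X Z : Str) → lcp (X ++ Z) X ≡ length X
lcp-prefix X Z = begin
  lcp (X ++ Z) X        ≡⟨ cong (lcp (X ++ Z)) (sym (++-identityʳ X)) ⟩
  lcp (X ++ Z) (X ++ []) ≡⟨ lcp-++ X Z [] ⟩
  length X + lcp Z []   ≡⟨ cong (length X +_) (lcp-[]ʳ Z) ⟩
  length X + 0          ≡⟨ +-identityʳ (length X) ⟩
  length X              ∎
  where open ≡-Reasoning

lcp-branch : ∀ (P : Str) {a b} (Z Z′ : Str) → a ≢ b → lcp (P ++ a ∷ Z) (P ++ b ∷ Z′) ≡ length P
lcp-branch P Z Z′ a≢b = begin
  lcp (P ++ _ ∷ Z) (P ++ _ ∷ Z′) ≡⟨ lcp-++ P _ _ ⟩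
  length P + lcp (_ ∷ Z) (_ ∷ Z′) ≡⟨ cong (length P +_) (lcp-≢ Z Z′ a≢b) ⟩
  length P + 0                   ≡⟨ +-identityʳ (length P) ⟩
  length P                       ∎
  where open ≡-Reasoning

lcp-exceeds : ∀ (W X R Q : Str) → X ≢ [] → length W < lcp (W ++ X ++ R) (W ++ X ++ Q)
lcp-exceeds W X R Q X≢[] = <-≤-trans (length-++-nonempty W X X≢[])
  (subst₂ (λ a b → length (W ++ X) ≤ lcp a b) (++-assoc W X R) (++-assoc W X Q)
          (lcp-common-prefix (W ++ X) R Q))

lcp-past-prefix : ∀ (A B R Y Z : Str) → A ++ B ≡ Y ++ Z → lcp (A ++ B ++ R) Y ≡ length Y
lcp-past-prefix A B R Y Z eq = begin
  lcp (A ++ B ++ R) Y     ≡⟨ cong (λ z → lcp z Y) (sym (++-assoc A B R)) ⟩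
  lcp ((A ++ B) ++ R) Y   ≡⟨ cong (λ z → lcp (z ++ R) Y) eq ⟩
  lcp ((Y ++ Z) ++ R) Y   ≡⟨ cong (λ z → lcp z Y) (++-assoc Y Z R) ⟩
  lcp (Y ++ Z ++ R) Y     ≡⟨ lcp-prefix Y (Z ++ R) ⟩
  length Y                ∎
  where open ≡-Reasoning

lcp-past-branch : ∀ (A B R P : Str) {a b} Z Z′ → a ≢ b → A ++ B ≡ P ++ a ∷ Z →
  lcp (A ++ B ++ R) (P ++ b ∷ Z′) ≡ length P
lcp-past-branch A B R P Z Z′ a≢b eq = begin
  lcp (A ++ B ++ R) (P ++ _ ∷ Z′)        ≡⟨ cong (λ z → lcp z (P ++ _ ∷ Z′)) (sym (++-assoc A B R)) ⟩
  lcp ((A ++ B) ++ R) (P ++ _ ∷ Z′)      ≡⟨ cong (λ z → lcp (z ++ R) (P ++ _ ∷ Z′)) eq ⟩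
  lcp ((P ++ _ ∷ Z) ++ R) (P ++ _ ∷ Z′)  ≡⟨ cong (λ z → lcp z (P ++ _ ∷ Z′)) (++-assoc P (_ ∷ Z) R) ⟩
  lcp (P ++ _ ∷ Z ++ R) (P ++ _ ∷ Z′)    ≡⟨ lcp-branch P (Z ++ R) Z′ a≢b ⟩
  length P                               ∎
  where open ≡-Reasoning

≤lex⇒<lex⊎≡ : ∀ {X Y} → X ≤lex Y → X <lex Y ⊎ X ≡ Y
≤lex⇒<lex⊎≡ (base _)   = inj₂ refl
≤lex⇒<lex⊎≡ halt       = inj₁ halt
≤lex⇒<lex⊎≡ (this x<y) = inj₁ (this x<y)
≤lex⇒<lex⊎≡ (next refl X≤Y) with ≤lex⇒<lex⊎≡ X≤Y
... | inj₁ X<Y = inj₁ (next refl X<Y)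
... | inj₂ refl = inj₂ refl

≤lex-refl : ∀ {X} → X ≤lex X
≤lex-refl {[]}    = base tt
≤lex-refl {x ∷ X} = next refl ≤lex-refl

≤lex-trans : ∀ {X Y Z} → X ≤lex Y → Y ≤lex Z → X ≤lex Z
≤lex-trans = ≤-transitive isEquivalence <-resp₂-≡ <-trans

<lex-trans : ∀ {X Y Z} → X <lex Y → Y <lex Z → X <lex Z
<lex-trans = <-transitive isEquivalence <-resp₂-≡ <-trans

<lex-irrefl : ∀ {X} → ¬ (X <lex X)
<lex-irrefl (base ())
<lex-irrefl (this x<x)   = <-irrefl refl x<x
<lex-irrefl (next _ X<X) = <lex-irrefl X<X

≮lex⇒≥lex : ∀ X Y → ¬ (Y <lex X) → X ≤lex Y
≮lex⇒≥lex []      []      _   = base tt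
≮lex⇒≥lex []      (y ∷ Y) _   = halt
≮lex⇒≥lex (x ∷ X) []      Y≮X = ⊥-elim (Y≮X halt)
≮lex⇒≥lex (x ∷ X) (y ∷ Y) Y≮X with <-cmp x y
... | tri< x<y _ _ = this x<y
... | tri> _ _ y<x = ⊥-elim (Y≮X (this y<x))
... | tri≈ _ refl _ = next refl (≮lex⇒≥lex X Y (λ Y<X → Y≮X (next refl Y<X)))

≤lex-++ˡ : ∀ (w : Str) {X Y} → X ≤lex Y → (w ++ X) ≤lex (w ++ Y)
≤lex-++ˡ []      X≤Y = X≤Y
≤lex-++ˡ (x ∷ w) X≤Y = next refl (≤lex-++ˡ w X≤Y)

≤lex-cancelˡ : ∀ (w : Str) {X Y} → (w ++ X) ≤lex (w ++ Y) → X ≤lex Y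
≤lex-cancelˡ []      X≤Y         = X≤Y
≤lex-cancelˡ (x ∷ w) (this x<x)  = ⊥-elim (<-irrefl refl x<x)
≤lex-cancelˡ (x ∷ w) (next _ le) = ≤lex-cancelˡ w le

⊑-refl : ∀ o {X} → X ⊑⟨ o ⟩ X
⊑-refl lexO = ≤lex-refl
⊑-refl posO = ≤-refl

⊑-trans : ∀ o {X Y Z} → X ⊑⟨ o ⟩ Y → Y ⊑⟨ o ⟩ Z → X ⊑⟨ o ⟩ Z
⊑-trans lexO = ≤lex-trans
⊑-trans posO X⊑Y Y⊑Z = ≤-trans Y⊑Z X⊑Y

⊑-⊏-trans : ∀ o {X Y Z} → X ⊑⟨ o ⟩ Y → Y ⊏⟨ o ⟩ Z → X ⊏⟨ o ⟩ Z
⊑-⊏-trans lexO X≤Y Y<Z with ≤lex⇒<lex⊎≡ X≤Y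
... | inj₁ X<Y = <lex-trans X<Y Y<Z
... | inj₂ refl = Y<Z
⊑-⊏-trans posO X⊑Y Y⊏Z = <-≤-trans Y⊏Z X⊑Y

⊏-⊑-trans : ∀ o {X Y Z} → X ⊏⟨ o ⟩ Y → Y ⊑⟨ o ⟩ Z → X ⊏⟨ o ⟩ Z
⊏-⊑-trans lexO X<Y Y≤Z with ≤lex⇒<lex⊎≡ Y≤Z
... | inj₁ Y<Z = <lex-trans X<Y Y<Z
... | inj₂ refl = X<Y
⊏-⊑-trans posO X⊏Y Y⊑Z = ≤-<-trans Y⊑Z X⊏Y

⊏-irrefl : ∀ o {X} → ¬ (X ⊏⟨ o ⟩ X)
⊏-irrefl lexO = <lex-irrefl
⊏-irrefl posO = <-irrefl refl

⊏-⊑-asym : ∀ o {X Y} → X ⊏⟨ o ⟩ Y → Y ⊑⟨ o ⟩ X → ⊥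
⊏-⊑-asym o X⊏Y Y⊑X = ⊏-irrefl o (⊏-⊑-trans o X⊏Y Y⊑X)

⊑-total : ∀ o X Y → ¬ (Y ⊏⟨ o ⟩ X) → X ⊑⟨ o ⟩ Y
⊑-total lexO = ≮lex⇒≥lex
⊑-total posO X Y = ≮⇒≥

_⊏⟨_⟩?_ : ∀ X o Y → Dec (X ⊏⟨ o ⟩ Y)
X ⊏⟨ lexO ⟩? Y = <-decidable _≟_ _<?_ X Y
X ⊏⟨ posO ⟩? Y = length Y <? length X

⊑-++ˡ : ∀ o (w : Str) {X Y} → X ⊑⟨ o ⟩ Y → (w ++ X) ⊑⟨ o ⟩ (w ++ Y)
⊑-++ˡ lexO w X≤Y = ≤lex-++ˡ w X≤Y
⊑-++ˡ posO w {X} {Y} X⊑Y rewrite length-++ w {Y} | length-++ w {X} = +-monoʳ-≤ (length w) X⊑Y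

⊑-cancelˡ : ∀ o (w : Str) {X Y} → (w ++ X) ⊑⟨ o ⟩ (w ++ Y) → X ⊑⟨ o ⟩ Y
⊑-cancelˡ lexO w le = ≤lex-cancelˡ w le
⊑-cancelˡ posO w {X} {Y} le rewrite length-++ w {Y} | length-++ w {X} = +-cancelˡ-≤ (length w) _ _ le

module Occurrences (T : Str) where
  open Text T

  n≡|u++Y| : ∀ u Y → T ≡ u ++ Y → n ≡ length u + length Y
  n≡|u++Y| u Y e = trans (cong length e) (length-++ u)

  pos-suffix : ∀ u Y → T ≡ u ++ Y → pos Y ≡ suc (length u)
  pos-suffix u Y e = trans (cong (λ k → suc k ∸ length Y) (n≡|u++Y| u Y e)) (m+n∸n≡m (suc (length u)) (length Y))

  Suf-suffix : ∀ u Y → T ≡ u ++ Y → Suf (suc (length u)) ≡ Y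
  Suf-suffix u Y e = trans (cong (drop (length u)) e) (drop-length-++ u Y)

  suffix-start< : ∀ u Y → T ≡ u ++ Y → Y ≢ [] → length u < n
  suffix-start< u Y e Y≢[] = subst (length u <_) (sym (cong length e)) (length-++-nonempty u Y Y≢[])

  Suf-pos-suffix : ∀ u Y → T ≡ u ++ Y → Y ≢ [] → 1 ≤ pos Y × pos Y ≤ n × Suf (pos Y) ≡ Y
  Suf-pos-suffix u Y e Y≢[] = subst (λ k → 1 ≤ k × k ≤ n × Suf k ≡ Y) (sym (pos-suffix u Y e))
    (s≤s z≤n , suffix-start< u Y e Y≢[] , Suf-suffix u Y e)

  Suf-split : ∀ q → 1 ≤ q → q ≤ n → ∃[ u ] (T ≡ u ++ Suf q × Suf q ≢ [])
  Suf-split (suc q) _ q<n = take q T , sym (take++drop≡id q T) , drop≢[]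
    where
    drop≢[] : drop q T ≢ []
    drop≢[] e = <-irrefl refl
      (subst (λ z → 0 < length z) e (subst (0 <_) (sym (length-drop q T)) (m<n⇒0<n∸m q<n)))

  pos-Suf : ∀ q → 1 ≤ q → q ≤ n → pos (Suf q) ≡ q
  pos-Suf (suc q) _ q<n = trans (pos-suffix (take q T) (drop q T) (sym (take++drop≡id q T)))
    (cong suc (trans (length-take q T) (m≤n⇒m⊓n≡m (<⇒≤ q<n))))

  factor-length : ∀ {X} → Factor X → length X ≤ n
  factor-length {X} (u , w , e) = begin
    length X               ≤⟨ m≤m+n (length X) (length w) ⟩
    length X + length w    ≡⟨ length-++ X ⟨
    length (X ++ w)        ≤⟨ m≤n+m _ (length u) ⟩
    length u + length (X ++ w) ≡⟨ n≡|u++Y| u (X ++ w) e ⟨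
    n                      ∎
    where open ≤-Reasoning

  suffix-factor : ∀ {X} → IsSuffix X → Factor X
  suffix-factor {X} (u , e) = u , [] , trans e (cong (u ++_) (sym (++-identityʳ X)))

  factor-++ˡ : ∀ {A B} → Factor (A ++ B) → Factor A
  factor-++ˡ {A} {B} (u , w , e) = u , B ++ w , trans e (cong (u ++_) (++-assoc A B w))

  branch⇒RightMax : ∀ {P a b Z Z′} → a ≢ b → Factor (P ++ a ∷ Z) → Factor (P ++ b ∷ Z′) → RightMax P
  branch⇒RightMax {P} {a} {b} {Z} {Z′} a≢b fa fb =
    a , b , a≢b ,
    factor-++ˡ {B = Z} (subst Factor (sym (++-assoc P (a ∷ []) Z)) fa) ,
    factor-++ˡ {B = Z′} (subst Factor (sym (++-assoc P (b ∷ []) Z′)) fb)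

  end-determines-prefix : ∀ u X w u′ X′ w′ → T ≡ u ++ X ++ w → T ≡ u′ ++ X′ ++ w′
    → length (u ++ X) ≡ length (u′ ++ X′) → u ++ X ≡ u′ ++ X′ × w ≡ w′
  end-determines-prefix u X w u′ X′ w′ e e′ len =
    ++-cancel-length (u ++ X) (u′ ++ X′) (begin
      (u ++ X) ++ w      ≡⟨ ++-assoc u X w ⟩
      u ++ X ++ w        ≡⟨ e ⟨
      T                  ≡⟨ e′ ⟩
      u′ ++ X′ ++ w′     ≡⟨ ++-assoc u′ X′ w′ ⟨
      (u′ ++ X′) ++ w′   ∎) len
    where open ≡-Reasoning

  endsAt-++ˡ : ∀ u {x j} → EndsAt (u ++ x) j → EndsAt x j
  endsAt-++ˡ u {x} (a , w , e , l) =
    a ++ u , w ,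
    trans e (trans (cong (a ++_) (++-assoc u x w)) (sym (++-assoc a u (x ++ w)))) ,
    trans (cong length (++-assoc a u x)) l

  SameEndPos-refl : ∀ {x} → SameEndPos x x
  SameEndPos-refl j = (λ h → h) , (λ h → h)

  SameEndPos-trans : ∀ {x y z} → SameEndPos x y → SameEndPos y z → SameEndPos x z
  SameEndPos-trans s t j = (λ h → proj₁ (t j) (proj₁ (s j) h)) , (λ h → proj₂ (s j) (proj₂ (t j) h))

  SameEndPos-++ʳ : ∀ u {x y} R → y ≡ u ++ x → SameEndPos x y → SameEndPos (x ++ R) (y ++ R)
  SameEndPos-++ʳ u {x} {y} R refl s j = extend , endsAt-++ˡ u ∘′ subst (λ z → EndsAt z j) (++-assoc u x R)
    where
    extend : EndsAt (x ++ R) j → EndsAt (y ++ R) j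
    extend (a , b , e , l) with e₁ ← trans e (cong (a ++_) (++-assoc x R b))
                           with proj₁ (s (length (a ++ x))) (a , R ++ b , e₁ , refl)
    ... | a′ , b′ , e′ , l′ with end-determines-prefix a′ y b′ a x (R ++ b) e′ e₁ l′
    ... | a′y≡ax , refl = a′ , b , trans e′ (cong (a′ ++_) (sym (++-assoc y R b))) , (begin
      length (a′ ++ y ++ R)   ≡⟨ cong length (++-assoc a′ y R) ⟨
      length ((a′ ++ y) ++ R) ≡⟨ cong (λ z → length (z ++ R)) a′y≡ax ⟩
      length ((a ++ x) ++ R)  ≡⟨ cong length (++-assoc a x R) ⟩
      length (a ++ x ++ R)    ≡⟨ l ⟩
      j                       ∎)
      where open ≡-Reasoning

  suffix⇒endsAt-n : ∀ {x} → IsSuffix x → EndsAt x n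
  suffix⇒endsAt-n {x} (u , e) = u , [] , trans e (cong (u ++_) (sym (++-identityʳ x))) , cong length (sym e)

  endsAt-n⇒suffix : ∀ {x} → EndsAt x n → IsSuffix x
  endsAt-n⇒suffix {x} (a , w , e , l) =
    a , sym (proj₁ (++-cancel-length (a ++ x) T (trans (++-assoc a x w) (trans (sym e) (sym (++-identityʳ T)))) l))

  SameEndPos-suffix : ∀ {x y} → SameEndPos x y → IsSuffix x → IsSuffix y
  SameEndPos-suffix s sx = endsAt-n⇒suffix (proj₁ (s n) (suffix⇒endsAt-n sx))

  SameEndPos-factor-++ʳ : ∀ u {x y} R → y ≡ u ++ x → SameEndPos x y → Factor (x ++ R) → Factor (y ++ R)
  SameEndPos-factor-++ʳ u R y≡ux s (a , b , e) with proj₁ (SameEndPos-++ʳ u R y≡ux s _) (a , b , e , refl)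
  ... | a′ , b′ , e′ , _ = a′ , b′ , e′

  SameEndPos-STNode : ∀ u {x y} → y ≡ u ++ x → SameEndPos x y → STNode x → STNode y
  SameEndPos-STNode u y≡ux s (inj₁ (a , b , a≢b , fa , fb)) =
    inj₁ (a , b , a≢b , SameEndPos-factor-++ʳ u (a ∷ []) y≡ux s fa , SameEndPos-factor-++ʳ u (b ∷ []) y≡ux s fb)
  SameEndPos-STNode u y≡ux s (inj₂ sx) = inj₂ (SameEndPos-suffix s sx)

  preceded-by : ∀ {x u′ c a} → SameEndPos x (u′ ∷ʳ c ++ x) → Factor (a ∷ x) → a ≡ c
  preceded-by {x} {u′} {c} {a} s (p , r , e) with e₁ ← trans e (sym (∷ʳ-++ p a (x ++ r)))
                                             with proj₁ (s _) (p ∷ʳ a , r , e₁ , refl)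
  ... | q , r′ , e′ , l′ = sym (∷ʳ-injectiveʳ (q ++ u′) p (++-cancelʳ x _ _ (begin
    (q ++ u′) ∷ʳ c ++ x  ≡⟨ ∷ʳ-++ (q ++ u′) c x ⟩
    (q ++ u′) ++ c ∷ x   ≡⟨ ++-assoc q u′ (c ∷ x) ⟩
    q ++ u′ ++ c ∷ x     ≡⟨ cong (q ++_) (∷ʳ-++ u′ c x) ⟨
    q ++ u′ ∷ʳ c ++ x    ≡⟨ proj₁ (end-determines-prefix q (u′ ∷ʳ c ++ x) r′ (p ∷ʳ a) x r e′ e₁ l′) ⟩
    p ∷ʳ a ++ x          ∎)))
    where open ≡-Reasoning

  leftMax-longest : ∀ {x} u → LeftMax x → SameEndPos x (u ++ x) → u ≡ []
  leftMax-longest u lm s with initLast u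
  ... | [] = refl
  leftMax-longest {x} _ (inj₁ (w , e)) s | u′ ∷ʳ′ c with proj₁ (s (length x)) ([] , w , e , refl)
  ... | q , _ , _ , l = ⊥-elim (<-irrefl (sym l) (begin-strict
    length x               <⟨ n<1+n (length x) ⟩
    length (c ∷ x)         ≤⟨ length-++-≤ʳ (c ∷ x) {q ++ u′} ⟩
    length ((q ++ u′) ++ c ∷ x) ≡⟨ cong length (++-assoc q u′ (c ∷ x)) ⟩
    length (q ++ u′ ++ c ∷ x)   ≡⟨ cong (λ z → length (q ++ z)) (∷ʳ-++ u′ c x) ⟨
    length (q ++ u′ ∷ʳ c ++ x) ∎))
    where open ≤-Reasoning
  leftMax-longest _ (inj₂ (a , b , a≢b , fa , fb)) s | u′ ∷ʳ′ c =
    ⊥-elim (a≢b (trans (preceded-by s fa) (sym (preceded-by s fb))))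

  IsPrefix? : ∀ X → Dec (IsPrefix X)
  IsPrefix? X = prefix? X T

  IsSuffix? : ∀ X → Dec (IsSuffix X)
  IsSuffix? X with ≡-dec _≟_ (drop (n ∸ length X) T) X
  ... | yes e = yes (take (n ∸ length X) T ,
                     trans (sym (take++drop≡id (n ∸ length X) T)) (cong (take (n ∸ length X) T ++_) e))
  ... | no ne = no λ { (u , e) → ne (begin
    drop (n ∸ length X) T                      ≡⟨ cong (λ k → drop (k ∸ length X) T) (n≡|u++Y| u X e) ⟩
    drop (length u + length X ∸ length X) T    ≡⟨ cong (λ k → drop k T) (m+n∸n≡m (length u) (length X)) ⟩
    drop (length u) T                          ≡⟨ cong (drop (length u)) e ⟩
    drop (length u) (u ++ X)                   ≡⟨ drop-length-++ u X ⟩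
    X                                          ∎) }
    where open ≡-Reasoning

  Factor? : ∀ X → Dec (Factor X)
  Factor? X with anyUpTo? (λ i → prefix? X (drop i T)) (suc n)
  ... | yes (i , _ , w , e) = yes (take i T , w , trans (sym (take++drop≡id i T)) (cong (take i T ++_) e))
  ... | no none = no λ { (u , w , e) → none (length u ,
          s≤s (subst (length u ≤_) (sym (n≡|u++Y| u (X ++ w) e)) (m≤m+n _ _)) ,
          w , trans (cong (drop (length u)) e) (drop-length-++ u (X ++ w))) }

  factor-∈ : ∀ {X a Y} → Factor (X ++ a ∷ Y) → a ∈ T
  factor-∈ {X} {a} {Y} (u , w , e) = subst (a ∈_) (sym e) (∈-++⁺ʳ u (∈-++⁺ˡ (∈-++⁺ʳ X (here refl))))

  ∃-symbol? : ∀ {P : ℕ → Set} → (∀ a → Dec (P a)) → (∀ {a} → P a → a ∈ T) → Dec (∃ P)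
  ∃-symbol? P? P⇒∈ with any? P? T
  ... | yes anyP = yes (proj₁ (find anyP) , proj₂ (proj₂ (find anyP)))
  ... | no ¬anyP = no λ (a , pa) → ¬anyP (lose (P⇒∈ pa) pa)

  RightMax? : ∀ X → Dec (RightMax X)
  RightMax? X =
    ∃-symbol? (λ a → ∃-symbol? (λ b → ¬? (a ≟ b) ×-dec Factor? (X ++ a ∷ []) ×-dec Factor? (X ++ b ∷ []))
                               (λ (_ , _ , fb) → factor-∈ {X} fb))
              (λ (_ , _ , fa , _) → factor-∈ {X} fa)

  STNode? : ∀ X → Dec (STNode X)
  STNode? X = RightMax? X ⊎-dec IsSuffix? X

  LeftMax? : ∀ X → Dec (LeftMax X)
  LeftMax? X = IsPrefix? X ⊎-dec
    ∃-symbol? (λ a → ∃-symbol? (λ b → ¬? (a ≟ b) ×-dec Factor? (a ∷ X) ×-dec Factor? (b ∷ X))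
                               (λ (_ , _ , fb) → factor-∈ {[]} fb))
              (λ (_ , _ , fa , _) → factor-∈ {[]} fa)

  extend-left : ∀ {x} → Factor x → ¬ LeftMax x → ∃[ a ] (Factor (a ∷ x) × SameEndPos x (a ∷ x))
  extend-left {x} (u , w , e) ¬lm with initLast u
  ... | [] = ⊥-elim (¬lm (inj₁ (w , e)))
  ... | u′ ∷ʳ′ a = a , fa , λ j → forward , endsAt-++ˡ (a ∷ [])
    where
    fa : Factor (a ∷ x)
    fa = u′ , w , trans e (∷ʳ-++ u′ a (x ++ w))
    forward : ∀ {j} → EndsAt x j → EndsAt (a ∷ x) j
    forward (p , r , e′ , l) with initLast p
    ... | [] = ⊥-elim (¬lm (inj₁ (r , e′)))
    ... | p′ ∷ʳ′ b with b ≟ a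
    ...   | no b≢a = ⊥-elim (¬lm (inj₂ (a , b , b≢a ∘′ sym , fa , p′ , r , trans e′ (∷ʳ-++ p′ b (x ++ r)))))
    ...   | yes refl = p′ , r , trans e′ (∷ʳ-++ p′ b (x ++ r)) , trans (cong length (sym (∷ʳ-++ p′ b x))) l

  leftMax-extension : ∀ x → Factor x → ∃[ u ] (LeftMax (u ++ x) × SameEndPos x (u ++ x))
  leftMax-extension x fx = go (suc n) x fx (m≤n+m (suc n) (length x))
    where
    go : ∀ k y → Factor y → n < length y + k → ∃[ u ] (LeftMax (u ++ y) × SameEndPos y (u ++ y))
    go zero y fy n<|y| = ⊥-elim (≤⇒≯ (factor-length fy) (subst (n <_) (+-identityʳ _) n<|y|))
    go (suc k) y fy bound with LeftMax? y
    ... | yes lm = [] , lm , SameEndPos-refl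
    ... | no ¬lm with extend-left fy ¬lm
    ... | a , fay , s₁ with go k (a ∷ y) fay (subst (n <_) (+-suc (length y) k) bound)
    ... | u , lm , s₂ = u ∷ʳ a , subst LeftMax eq lm , subst (SameEndPos y) eq (SameEndPos-trans s₁ s₂)
      where
      eq : u ++ a ∷ y ≡ u ∷ʳ a ++ y
      eq = sym (∷ʳ-++ u a y)

module Paths (T : Str) where
  open Text T
  open Occurrences T

  root-Node : Node root
  root-Node = inj₂ (T , sym (++-identityʳ T)) , inj₁ (T , refl)

  STNode⇒Factor : ∀ {X} → STNode X → Factor X
  STNode⇒Factor {X} (inj₁ (a , _ , _ , fa , _)) = factor-++ˡ {B = a ∷ []} fa
  STNode⇒Factor {X} (inj₂ sx) = suffix-factor sx

  module _ {w X v} (edge : IsEdge (w , X , v)) where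
    source-Node : Node w
    source-Node = proj₁ edge
    label≢[] : X ≢ []
    label≢[] = proj₁ (proj₂ edge)
    source++label-STNode : STNode (w ++ X)
    source++label-STNode = proj₁ (proj₂ (proj₂ edge))
    no-inner-STNode : ∀ X₁ X₂ → X ≡ X₁ ++ X₂ → X₁ ≢ [] → X₂ ≢ [] → ¬ STNode (w ++ X₁)
    no-inner-STNode = proj₁ (proj₂ (proj₂ (proj₂ edge)))
    target-Node : Node v
    target-Node = proj₁ (proj₂ (proj₂ (proj₂ (proj₂ edge))))
    target-extends : ∃[ u ] (v ≡ u ++ (w ++ X))
    target-extends = proj₁ (proj₂ (proj₂ (proj₂ (proj₂ (proj₂ edge)))))
    target-SameEndPos : SameEndPos (w ++ X) v
    target-SameEndPos = proj₂ (proj₂ (proj₂ (proj₂ (proj₂ (proj₂ edge)))))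

    edge-shift : ∀ R → ∃[ u ] (v ++ R ≡ u ++ (w ++ X ++ R) × SameEndPos (w ++ X ++ R) (v ++ R))
    edge-shift R with target-extends
    ... | u , v≡uwX =
      u , trans (cong (_++ R) v≡uwX) (trans (++-assoc u (w ++ X) R) (cong (u ++_) (++-assoc w X R))) ,
      subst (λ z → SameEndPos z (v ++ R)) (++-assoc w X R) (SameEndPos-++ʳ u R v≡uwX target-SameEndPos)

  EdgeTowards : Str → Str → Set
  EdgeTowards c R = ∃[ X ] ∃[ R′ ] ∃[ v ] (R ≡ X ++ R′ × IsEdge (c , X , v))

  Walk : Str → Str → Set
  Walk c R = ∃[ d ] ∃[ P ] ∃[ u ] (Path c d P × spell P ≡ R × d ≡ u ++ (c ++ R) × SameEndPos (c ++ R) d)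

  -- Opaque because with-abstraction over the unfolded shortest-prefix search exhausts memory.
  opaque
    edge-towards : ∀ {c R} → Node c → R ≢ [] → STNode (c ++ R) → EdgeTowards c R
    edge-towards {c} {R} nc R≢[] st
      with least (λ k → 1 ≤? k ×-dec STNode? (c ++ take k R))
                 (length-nonempty R≢[] , subst (λ z → STNode (c ++ z)) (sym (take-all (length R) R ≤-refl)) st)
    ... | k , (1≤k , stk) , k≤|R| , shorter with leftMax-extension (c ++ take k R) (STNode⇒Factor stk)
    ... | u , lm , s =
      take k R , drop k R , u ++ (c ++ take k R) , sym (take++drop≡id k R) ,
      nc , X≢[] , stk , no-inner , (SameEndPos-STNode u refl s stk , lm) , (u , refl) , s
      where
      |X|≡k : length (take k R) ≡ k
      |X|≡k = trans (length-take k R) (m≤n⇒m⊓n≡m k≤|R|)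
      X≢[] : take k R ≢ []
      X≢[] X≡[] = <-irrefl refl (≤-trans 1≤k (≤-reflexive (trans (sym |X|≡k) (cong length X≡[]))))
      no-inner : ∀ X₁ X₂ → take k R ≡ X₁ ++ X₂ → X₁ ≢ [] → X₂ ≢ [] → ¬ STNode (c ++ X₁)
      no-inner X₁ X₂ X≡X₁X₂ X₁≢[] X₂≢[] st₁ =
        shorter (subst (length X₁ <_) (trans (cong length (sym X≡X₁X₂)) |X|≡k) (length-++-nonempty X₁ X₂ X₂≢[]))
                (length-nonempty X₁≢[] , subst (λ z → STNode (c ++ z)) (sym take|X₁|) st₁)
        where
        take|X₁| : take (length X₁) R ≡ X₁
        take|X₁| = begin
          take (length X₁) R                        ≡⟨ cong (take (length X₁)) (sym (take++drop≡id k R)) ⟩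
          take (length X₁) (take k R ++ drop k R)   ≡⟨ cong (λ z → take (length X₁) (z ++ drop k R)) X≡X₁X₂ ⟩
          take (length X₁) ((X₁ ++ X₂) ++ drop k R) ≡⟨ cong (take (length X₁)) (++-assoc X₁ X₂ (drop k R)) ⟩
          take (length X₁) (X₁ ++ X₂ ++ drop k R)   ≡⟨ take-length-++ X₁ (X₂ ++ drop k R) ⟩
          X₁                                        ∎
          where open ≡-Reasoning

  walk : ∀ {c} R → Node c → STNode (c ++ R) → Walk c R
  walk R = go (length R) R ≤-refl
    where
    go : ∀ f {c} R → length R ≤ f → Node c → STNode (c ++ R) → Walk c R
    go _ {c} [] _ nc _ =
      c , [] , [] , nil , refl , sym (++-identityʳ c) ,
      subst (λ z → SameEndPos z c) (sym (++-identityʳ c)) SameEndPos-refl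
    go (suc f) {c} (r ∷ R) |R|≤f nc st = step (edge-towards nc (λ ()) st) |R|≤f st
      where
      step : ∀ {R} → EdgeTowards c R → length R ≤ suc f → STNode (c ++ R) → Walk c R
      step (X , R′ , v , refl , edge) |XR′|≤f st with edge-shift edge R′
      ... | u₁ , vR′≡ , s₁
        with go f R′ (≤-pred (≤-trans (length-nonempty-++ X R′ (label≢[] edge)) |XR′|≤f))
                (target-Node edge) (SameEndPos-STNode u₁ vR′≡ s₁ st)
      ... | d , P , u₂ , path , spellP , d≡ , s₂ =
        d , (c , X , v) ∷ P , u₂ ++ u₁ , cons edge path , cong (X ++_) spellP ,
        trans d≡ (trans (cong (u₂ ++_) vR′≡) (sym (++-assoc u₂ u₁ (c ++ X ++ R′)))) , SameEndPos-trans s₁ s₂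

  Path-target-Node : ∀ {a b P} → Path a b P → Node a → Node b
  Path-target-Node nil        na = na
  Path-target-Node (cons e p) _  = Path-target-Node p (target-Node e)

  root-path : ∀ {w} → Node w → ∃[ A ] (Path root w A × spell A ≡ w)
  root-path {w} (st , lm) with walk w root-Node st
  ... | d , A , u , path , spellA , d≡uw , s with leftMax-longest u lm (subst (SameEndPos w) d≡uw s)
  ... | refl = A , subst (λ z → Path root z A) d≡uw path , spellA

  spell-++ : ∀ P Q → spell (P ++ Q) ≡ spell P ++ spell Q
  spell-++ = concatMap-++ lab

  Path-++ : ∀ {a b c P Q} → Path a b P → Path b c Q → Path a c (P ++ Q)
  Path-++ nil        q = q
  Path-++ (cons e p) q = cons e (Path-++ p q)

  Path-++⁻ : ∀ {a c} P {Q} → Path a c (P ++ Q) → ∃[ b ] (Path a b P × Path b c Q)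
  Path-++⁻ []      p = _ , nil , p
  Path-++⁻ (f ∷ P) (cons e p) with Path-++⁻ P p
  ... | b , p₁ , p₂ = b , cons e p₁ , p₂

  Path-target-extends : ∀ {a b P} → Path a b P → ∃[ u ] (b ≡ u ++ (a ++ spell P))
  Path-target-extends {a} nil = [] , sym (++-identityʳ a)
  Path-target-extends (cons {w} {X} {v} {b} {P} e p) with edge-shift e (spell P) | Path-target-extends p
  ... | u₁ , vP≡ , _ | u₂ , b≡ = u₂ ++ u₁ , trans b≡ (trans (cong (u₂ ++_) vP≡) (sym (++-assoc u₂ u₁ _)))

  no-edge-from-sink : ∀ {X v} → ¬ IsEdge (sink , X , v)
  no-edge-from-sink {X} e =
    ≤⇒≯ (factor-length (STNode⇒Factor (source++label-STNode e))) (length-++-nonempty T X (label≢[] e))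

  Path-from-sink : ∀ {Q} → Path sink sink Q → Q ≡ []
  Path-from-sink nil        = refl
  Path-from-sink (cons e _) = ⊥-elim (no-edge-from-sink e)

module EndMarker (T : Str) (em : EndMarked T) where
  open Text T
  open Occurrences T
  open Paths T

  private
    T′ : Str
    T′ = proj₁ em
    d : ℕ
    d = proj₁ (proj₂ em)
    T≡T′d : T ≡ T′ ∷ʳ d
    T≡T′d = proj₁ (proj₂ (proj₂ em))
    d<T′ : All (d <_) T′
    d<T′ = proj₂ (proj₂ (proj₂ em))

  T≢[] : T ≢ []
  T≢[] T≡[] = ++-nonemptyʳ T′ (d ∷ []) (λ ()) (trans (sym T≡T′d) T≡[])

  marker-only-at-end : ∀ p r → T ≡ p ++ d ∷ r → r ≡ []
  marker-only-at-end p r e with initLast r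
  ... | [] = refl
  ... | r′ ∷ʳ′ c = ⊥-elim (<-irrefl refl (lookup d<T′ (subst (d ∈_) T′≡ (∈-++⁺ʳ p (here refl)))))
    where
    T′≡ : p ++ d ∷ r′ ≡ T′
    T′≡ = ∷ʳ-injectiveˡ (p ++ d ∷ r′) T′ (begin
      (p ++ d ∷ r′) ∷ʳ c  ≡⟨ ++-assoc p (d ∷ r′) (c ∷ []) ⟩
      p ++ d ∷ r′ ∷ʳ c    ≡⟨ e ⟨
      T                   ≡⟨ T≡T′d ⟩
      T′ ∷ʳ d             ∎)
      where open ≡-Reasoning

  suffix-occurs-only-at-end : ∀ {D} → IsSuffix D → D ≢ [] → ∀ p r → T ≡ p ++ D ++ r → r ≡ []
  suffix-occurs-only-at-end {D} (u , T≡uD) D≢[] p r e with initLast D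
  ... | [] = ⊥-elim (D≢[] refl)
  ... | D′ ∷ʳ′ c with ∷ʳ-injective (u ++ D′) T′ (trans (++-assoc u D′ (c ∷ [])) (trans (sym T≡uD) T≡T′d))
  ... | _ , refl = marker-only-at-end (p ++ D′) r (trans e (begin
    p ++ D′ ∷ʳ c ++ r   ≡⟨ cong (p ++_) (∷ʳ-++ D′ c r) ⟩
    p ++ D′ ++ c ∷ r    ≡⟨ ++-assoc p D′ (c ∷ r) ⟨
    (p ++ D′) ++ c ∷ r  ∎))
    where open ≡-Reasoning

  leftMax-suffix≡T : ∀ {D} → IsSuffix D → D ≢ [] → LeftMax D → D ≡ T
  leftMax-suffix≡T {D} (u , T≡uD) D≢[] lm with leftMax-longest u lm only-at-n
    where
    only-at-n : SameEndPos D (u ++ D)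
    only-at-n j = forward , endsAt-++ˡ u
      where
      forward : EndsAt D j → EndsAt (u ++ D) j
      forward (p , r , e , l) with suffix-occurs-only-at-end (u , T≡uD) D≢[] p r e
      ... | refl = subst (EndsAt (u ++ D)) n≡j (suffix⇒endsAt-n ([] , T≡uD))
        where
        n≡j : n ≡ j
        n≡j = trans (cong length e) (trans (cong (λ z → length (p ++ z)) (++-identityʳ D)) l)
  ... | refl = sym T≡uD

  path-to-sink : ∀ {v} a Z → Node v → T ≡ a ++ v ++ Z → v ++ Z ≢ [] → ∃[ B ] (Path v sink B × spell B ≡ Z)
  path-to-sink {v} a Z nv e vZ≢[] with walk Z nv (inj₂ (a , e))
  ... | d , B , u , path , spellB , d≡uvZ , s
    with leftMax-suffix≡T (SameEndPos-suffix s (a , e))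
                          (λ d≡[] → ++-nonemptyʳ u (v ++ Z) vZ≢[] (trans (sym d≡uvZ) d≡[]))
                          (proj₂ (Path-target-Node path nv))
  ... | refl = B , path , spellB

  Path-to-sink-nonempty : ∀ {a Q} → Path a sink Q → a ++ spell Q ≢ []
  Path-to-sink-nonempty {a} nil        = T≢[] ∘′ trans (sym (++-identityʳ T))
  Path-to-sink-nonempty {a} (cons e _) = ++-nonemptyʳ a _ (++-nonemptyˡ _ _ (label≢[] e))

module Representatives (T : Str) where
  open Text T
  open Paths T

  length-spell-++ : ∀ P Q → length (spell (P ++ Q)) ≡ length (spell P) + length (spell Q)
  length-spell-++ P Q = trans (cong length (spell-++ P Q)) (length-++ (spell P))

  root-path-spell-≤ : ∀ {w P} → Path root w P → length (spell P) ≤ length w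
  root-path-spell-≤ {w} {P} p with Path-target-extends p
  ... | u , w≡u++P =
    subst (length (spell P) ≤_) (sym (trans (cong length w≡u++P) (length-++ u))) (m≤n+m _ (length u))

  spell-IsReprMinus : ∀ {w A} → Path root w A → spell A ≡ w → IsReprMinus w A
  spell-IsReprMinus {w} pA refl = pA , λ Q pQ → root-path-spell-≤ pQ

  IsReprMinus-spell : ∀ {w A} → IsReprMinus w A → spell A ≡ w
  IsReprMinus-spell {w} {A} (pA , minimal) with Path-target-extends pA | root-path (Path-target-Node pA root-Node)
  ... | u , w≡uA | A₀ , pA₀ , spellA₀ =
    sym (suffix-≡-by-length u w≡uA (subst (λ z → length z ≤ length (spell A)) spellA₀ (minimal A₀ pA₀)))

  IsReprMinus-prefix : ∀ {m w} P Q → Path root m P → Path m w Q → IsReprMinus w (P ++ Q) → IsReprMinus m P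
  IsReprMinus-prefix P Q pP pQ (_ , minimal) = pP , λ P′ pP′ →
    +-cancelʳ-≤ (length (spell Q)) _ _
      (subst₂ _≤_ (length-spell-++ P′ Q) (length-spell-++ P Q) (minimal (P′ ++ Q) (Path-++ pP′ pQ)))

  IsReprMinus⇒All-PrimMinus : ∀ {m w} P Q → Path root m P → Path m w Q → IsReprMinus w (P ++ Q) → All PrimMinus Q
  IsReprMinus⇒All-PrimMinus P [] _ _ _ = []
  IsReprMinus⇒All-PrimMinus P (f ∷ Q) pP (cons e pQ) r =
    (P ∷ʳ f , IsReprMinus-prefix (P ∷ʳ f) Q pPf pQ r′ , P , refl)
    ∷ IsReprMinus⇒All-PrimMinus (P ∷ʳ f) Q pPf pQ r′
    where
    pPf : Path root _ (P ∷ʳ f)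
    pPf = Path-++ pP (cons e nil)
    r′ : IsReprMinus _ ((P ∷ʳ f) ++ Q)
    r′ = subst (IsReprMinus _) (sym (∷ʳ-++ P f Q)) r

  PrimMinus-target : ∀ {m X m′} → IsEdge (m , X , m′) → PrimMinus (m , X , m′) → m′ ≡ m ++ X
  PrimMinus-target {m} {X} {m′} e (.(P ∷ʳ _) , r@(pP , _) , P , refl) with Path-++⁻ P pP | target-extends e
  ... | _ , pP′ , cons _ nil | u , m′≡umX = suffix-≡-by-length u m′≡umX (begin
    length m′                                ≡⟨ cong length (IsReprMinus-spell r) ⟨
    length (spell (P ∷ʳ (m , X , m′)))       ≡⟨ length-spell-++ P _ ⟩
    length (spell P) + length (X ++ [])      ≡⟨ cong (λ z → length (spell P) + length z) (++-identityʳ X) ⟩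
    length (spell P) + length X              ≤⟨ +-monoˡ-≤ (length X) (root-path-spell-≤ pP′) ⟩
    length m + length X                      ≡⟨ length-++ m ⟨
    length (m ++ X)                          ∎)
    where open ≤-Reasoning

  All-PrimMinus-target : ∀ {m w A} → Path m w A → All PrimMinus A → w ≡ m ++ spell A
  All-PrimMinus-target {m} nil        []          = sym (++-identityʳ m)
  All-PrimMinus-target {m} (cons {X = X} {v} {w} {A} e p) (pm ∷ pms) = begin
    w                        ≡⟨ All-PrimMinus-target p pms ⟩
    v ++ spell A             ≡⟨ cong (_++ spell A) (PrimMinus-target e pm) ⟩
    (m ++ X) ++ spell A      ≡⟨ ++-assoc m X (spell A) ⟩
    m ++ X ++ spell A        ∎
    where open ≡-Reasoning

  module _ (o : Order) where

    IsReprPlus-suffix : ∀ {w X v S} → IsEdge (w , X , v) → IsReprPlus o w ((w , X , v) ∷ S) → IsReprPlus o v S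
    IsReprPlus-suffix {X = X} e (cons _ pS , minimal) = pS , λ Q pQ → ⊑-cancelˡ o X (minimal (_ ∷ Q) (cons e pQ))

    IsReprPlus⇒All-PrimPlus : ∀ {c S} → IsReprPlus o c S → All (PrimPlus o) S
    IsReprPlus⇒All-PrimPlus {S = []}    _ = []
    IsReprPlus⇒All-PrimPlus {S = f ∷ S} r@(cons e _ , _) =
      (f ∷ S , r , S , refl) ∷ IsReprPlus⇒All-PrimPlus (IsReprPlus-suffix e r)

    All-PrimPlus⇒IsReprPlus : ∀ {c S} → Path c sink S → All (PrimPlus o) S → IsReprPlus o c S
    All-PrimPlus⇒IsReprPlus nil [] =
      nil , λ Q pQ → subst (λ z → [] ⊑⟨ o ⟩ spell z) (sym (Path-from-sink pQ)) (⊑-refl o)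
    All-PrimPlus⇒IsReprPlus (cons {X = X} e pS) ((.(_ ∷ P′) , (cons _ pP′ , minimal) , P′ , refl) ∷ pps) =
      cons e pS , λ Q pQ → ⊑-trans o (⊑-++ˡ o X (proj₂ (All-PrimPlus⇒IsReprPlus pS pps) P′ pP′)) (minimal Q pQ)

module Glpf (T : Str) (o : Order) where
  open Text T
  open Occurrences T

  LcpBound : Str → ℕ → Set
  LcpBound Z ℓ = ∀ u Y → T ≡ u ++ Y → Y ≢ [] → Y ⊏⟨ o ⟩ Z → lcp Z Y ≤ ℓ

  IsGLPF-unique : ∀ p {ℓ₁ ℓ₂} → IsGLPF o p ℓ₁ → IsGLPF o p ℓ₂ → ℓ₁ ≡ ℓ₂
  IsGLPF-unique p g₁ g₂ = ≤-antisym (attained≤bound g₁ g₂) (attained≤bound g₂ g₁)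
    where
    attained≤bound : ∀ {ℓ₁ ℓ₂} → IsGLPF o p ℓ₁ → IsGLPF o p ℓ₂ → ℓ₁ ≤ ℓ₂
    attained≤bound (_ , inj₁ refl)                         _           = z≤n
    attained≤bound (_ , inj₂ (q , 1≤q , q≤n , lt , refl)) (upper , _) = upper q 1≤q q≤n lt

  IsGLPF⇒LcpBound : ∀ p {ℓ} → IsGLPF o p ℓ → LcpBound (Suf p) ℓ
  IsGLPF⇒LcpBound p {ℓ} (upper , _) u Y e Y≢[] lt with Suf-pos-suffix u Y e Y≢[]
  ... | 1≤ , ≤n , Suf≡Y =
    subst (λ z → lcp (Suf p) z ≤ ℓ) Suf≡Y (upper (pos Y) 1≤ ≤n (subst (_⊏⟨ o ⟩ _) (sym Suf≡Y) lt))

  IsGLPF-intro : ∀ u {Z ℓ} → T ≡ u ++ Z → Z ≢ [] → LcpBound Z ℓ →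
    (ℓ ≡ 0 ⊎ ∃[ q ] (1 ≤ q × q ≤ n × Suf q ⊏⟨ o ⟩ Z × lcp Z (Suf q) ≡ ℓ)) → IsGLPF o (pos Z) ℓ
  IsGLPF-intro u {Z} {ℓ} e Z≢[] bound attained =
    subst (λ W → (∀ q → 1 ≤ q → q ≤ n → Suf q ⊏⟨ o ⟩ W → lcp W (Suf q) ≤ ℓ)
                 × (ℓ ≡ 0 ⊎ ∃[ q ] (1 ≤ q × q ≤ n × Suf q ⊏⟨ o ⟩ W × lcp W (Suf q) ≡ ℓ)))
          (sym (proj₂ (proj₂ (Suf-pos-suffix u Z e Z≢[]))))
          ( (λ q 1≤q q≤n lt → let (u′ , e′ , Suf≢[]) = Suf-split q 1≤q q≤n in bound u′ (Suf q) e′ Suf≢[] lt)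
          , attained)

  IsGLPF-zero : ∀ p {ℓ} → IsGLPF o p ℓ → ¬ (∃[ i ] (i < n × Suf (suc i) ⊏⟨ o ⟩ Suf p)) → ℓ ≡ 0
  IsGLPF-zero p (_ , inj₁ ℓ≡0) _ = ℓ≡0
  IsGLPF-zero p (_ , inj₂ (suc i , _ , q≤n , lt , _)) none = ⊥-elim (none (i , q≤n , lt))

  IsGLPF-witness : ∀ p {ℓ} → IsGLPF o p ℓ → ∃[ i ] (i < n × Suf (suc i) ⊏⟨ o ⟩ Suf p) →
    ∃[ q ] (1 ≤ q × q ≤ n × Suf q ⊏⟨ o ⟩ Suf p × lcp (Suf p) (Suf q) ≡ ℓ)
  IsGLPF-witness p (_     , inj₂ attained) _ = attained
  IsGLPF-witness p (upper , inj₁ refl) (i , i<n , lt) =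
    suc i , s≤s z≤n , i<n , lt , n≤0⇒n≡0 (upper (suc i) (s≤s z≤n) i<n lt)

  secondary⇒nontrivial : ∀ {S A f B} → S ≡ A ++ f ∷ B → Secondary o f → ¬ Trivial o S
  secondary⇒nontrivial {A = A} refl (_ , ¬prim) trivial with ++⁻ʳ A trivial
  ... | prim ∷ _ = ¬prim prim

  CanonicalDescription : ℕ → ℕ → Set
  CanonicalDescription p ℓ = ∃[ S ] (Canonical o S × p ≡ pos (spell S)
    × (Trivial o S → ℓ ≡ 0)
    × (¬ Trivial o S
       → ∃[ w ] ∃[ X ] ∃[ v ] ∃[ A ] ∃[ B ]
           (CanoCert o S (w , X , v)
           × IsReprMinus w A × IsReprPlus o v B
           × S ≡ A ++ (w , X , v) ∷ B
           × ℓ ≡ length (spell A))))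

module GlpfOfCanonical (T : Str) (em : EndMarked T) (o : Order) where
  open Text T
  open Occurrences T
  open Paths T
  open EndMarker T em
  open Representatives T
  open Glpf T o

  trivial-GLPF : ∀ {S} → Path root sink S → All (PrimPlus o) S → IsGLPF o (pos (spell S)) 0
  trivial-GLPF {S} pS pps with Path-target-extends pS
  ... | u , T≡uS = IsGLPF-intro u T≡uS (Path-to-sink-nonempty pS) nothing-smaller (inj₁ refl)
    where
    nothing-smaller : LcpBound (spell S) 0
    nothing-smaller u′ Y e′ Y≢[] Y⊏S with path-to-sink u′ Y root-Node e′ Y≢[]
    ... | Q , pQ , refl = ⊥-elim (⊏-⊑-asym o Y⊏S (proj₂ (All-PrimPlus⇒IsReprPlus o pS pps) Q pQ))

  long-lcp-follows-edge : ∀ {w X v R u Y} → IsEdge (w , X , v) → T ≡ u ++ Y → length w < lcp (w ++ X ++ R) Y →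
    ∃[ Z ] (Y ≡ w ++ X ++ Z)
  long-lcp-follows-edge {w} {X} {v} {R} {u} {Y} edge T≡uY |w|<lcp with prefix-trichotomy (w ++ X) Y
  ... | inj₁ (Z , Y≡wXZ) = Z , trans Y≡wXZ (++-assoc w X Z)
  ... | inj₂ (inj₁ (Z , Z≢[] , wX≡YZ))
    with beyond-prefix w Y wX≡YZ (subst (length w <_) (lcp-past-prefix w X R Y Z wX≡YZ) |w|<lcp)
  ... | z , z≢[] , Y≡wz , X≡zZ =
    ⊥-elim (no-inner-STNode edge z Z X≡zZ z≢[] Z≢[] (subst STNode Y≡wz (inj₂ (u , T≡uY))))
  long-lcp-follows-edge {w} {X} {v} {R} {u} edge T≡uY |w|<lcp
    | inj₂ (inj₂ (P , a , b , Z , Z′ , a≢b , wX≡PaZ , refl))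
    with beyond-prefix w P wX≡PaZ (subst (length w <_) (lcp-past-branch w X R P Z Z′ a≢b wX≡PaZ) |w|<lcp)
  ... | z , z≢[] , P≡wz , X≡zaZ =
    ⊥-elim (no-inner-STNode edge z (a ∷ Z) X≡zaZ z≢[] (λ ())
              (subst STNode P≡wz (inj₁ (branch⇒RightMax a≢b fa fb))))
    where
    fa : Factor (P ++ a ∷ Z)
    fa = subst Factor wX≡PaZ (STNode⇒Factor (source++label-STNode edge))
    fb : Factor (P ++ b ∷ Z′)
    fb = suffix-factor (u , T≡uY)

  not-below-repr : ∀ {w X v B} u {Z} → IsEdge (w , X , v) → IsReprPlus o v B → T ≡ u ++ (w ++ X ++ Z) →
    ¬ ((w ++ X ++ Z) ⊏⟨ o ⟩ (w ++ X ++ spell B))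
  not-below-repr {w} {X} {v} {B} u {Z} edge (_ , minimal) T≡ lt with edge-shift edge Z
  ... | u₁ , vZ≡ , s with SameEndPos-suffix s (u , T≡)
  ... | a , T≡avZ with path-to-sink a Z (target-Node edge) T≡avZ vZ≢[]
    where
    vZ≢[] : v ++ Z ≢ []
    vZ≢[] = subst (_≢ []) (sym vZ≡) (++-nonemptyʳ u₁ _ (++-nonemptyʳ w _ (++-nonemptyˡ X Z (label≢[] edge))))
  ... | B′ , pB′ , refl = ⊏-⊑-asym o lt (⊑-++ˡ o w (⊑-++ˡ o X (minimal B′ pB′)))

  certificate-lcp-bound : ∀ {w X v B} → IsEdge (w , X , v) → IsReprPlus o v B →
    LcpBound (w ++ X ++ spell B) (length w)
  certificate-lcp-bound {w} {X} {v} {B} edge rB u Y T≡uY _ Y⊏ with lcp (w ++ X ++ spell B) Y ≤? length w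
  ... | yes lcp≤|w| = lcp≤|w|
  ... | no lcp≰|w| with long-lcp-follows-edge edge T≡uY (≰⇒> lcp≰|w|)
  ... | Z , refl = ⊥-elim (not-below-repr u edge rB T≡uY Y⊏)

  secondary⇒smaller-suffix : ∀ {w X v B} → IsEdge (w , X , v) → IsReprPlus o v B → ¬ PrimPlus o (w , X , v) →
    ∃[ q ] (1 ≤ q × q ≤ n × Suf q ⊏⟨ o ⟩ (w ++ X ++ spell B) × ∃[ W ] (Suf q ≡ w ++ W))
  secondary⇒smaller-suffix {w} {X} {v} {B} edge (pB , _) ¬prim
    with anyUpTo? (λ i → (Suf (suc i) ⊏⟨ o ⟩? (w ++ X ++ spell B)) ×-dec prefix? w (Suf (suc i))) n
  ... | yes (i , i<n , lt , W , Suf≡) = suc i , s≤s z≤n , i<n , lt , W , Suf≡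
  ... | no none = ⊥-elim (¬prim ((w , X , v) ∷ B , (cons edge pB , minimal) , B , refl))
    where
    minimal : ∀ Q → Path w sink Q → (X ++ spell B) ⊑⟨ o ⟩ spell Q
    minimal Q pQ with Path-target-extends pQ
    ... | u , T≡uwQ = ⊑-cancelˡ o w (⊑-total o _ _ λ lt → none
      (length u , suffix-start< u _ T≡uwQ (Path-to-sink-nonempty pQ) ,
       subst (_⊏⟨ o ⟩ _) (sym (Suf-suffix u _ T≡uwQ)) lt , spell Q , Suf-suffix u _ T≡uwQ))

  certificate-GLPF : ∀ {S A w X v B} → Path root sink S → S ≡ A ++ (w , X , v) ∷ B → spell A ≡ w →
    Secondary o (w , X , v) → IsReprPlus o v B → IsGLPF o (pos (spell S)) (length w)
  certificate-GLPF {S} {A} {w} {X} {v} {B} pS refl refl (edge , ¬prim) rB with Path-target-extends pS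
  ... | u , T≡uS = subst (λ Z → IsGLPF o (pos Z) (length w)) (sym spellS)
    (IsGLPF-intro u T≡u++ (subst (_≢ []) spellS (Path-to-sink-nonempty pS)) bound (inj₂ attained))
    where
    spellS : spell S ≡ w ++ X ++ spell B
    spellS = spell-++ A _
    T≡u++ : T ≡ u ++ (w ++ X ++ spell B)
    T≡u++ = trans T≡uS (cong (u ++_) spellS)
    bound : LcpBound (w ++ X ++ spell B) (length w)
    bound = certificate-lcp-bound edge rB
    attained : ∃[ q ] (1 ≤ q × q ≤ n × Suf q ⊏⟨ o ⟩ (w ++ X ++ spell B)
                       × lcp (w ++ X ++ spell B) (Suf q) ≡ length w)
    attained with secondary⇒smaller-suffix edge rB ¬prim
    ... | q , 1≤q , q≤n , lt , W , Suf≡ with Suf-split q 1≤q q≤n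
    ... | u′ , T≡u′Suf , Suf≢[] = q , 1≤q , q≤n , lt ,
      ≤-antisym (bound u′ (Suf q) T≡u′Suf Suf≢[] lt)
                (subst (λ z → length w ≤ lcp (w ++ X ++ spell B) z) (sym Suf≡)
                       (lcp-common-prefix w (X ++ spell B) W))

  InGLPF~⇒IsGLPF×LeftMax : ∀ {p ℓ} → InGLPF~ o p ℓ → IsGLPF o p ℓ × LeftMax (take ℓ (Suf p))
  InGLPF~⇒IsGLPF×LeftMax (S , (pS , inj₁ trivial) , refl , g)
    with IsGLPF-unique (pos (spell S)) g (trivial-GLPF pS trivial)
  ... | refl = g , inj₁ (T , refl)
  InGLPF~⇒IsGLPF×LeftMax (S , (pS , inj₂ ((w , X , v) , A , B , refl , pms , sec , pps)) , refl , g)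
    with Path-++⁻ A pS
  ... | _ , pA , cons edge pB with All-PrimMinus-target pA pms
  ... | refl with IsGLPF-unique (pos (spell S)) g
                   (certificate-GLPF pS refl refl sec (All-PrimPlus⇒IsReprPlus o pB pps))
  ... | refl = g , subst LeftMax (sym take|A|) (proj₂ (source-Node edge))
    where
    take|A| : take (length (spell A)) (Suf (pos (spell S))) ≡ spell A
    take|A| with Path-target-extends pS
    ... | u , T≡uS = begin
      take (length (spell A)) (Suf (pos (spell S)))
        ≡⟨ cong (take _) (proj₂ (proj₂ (Suf-pos-suffix u _ T≡uS (Path-to-sink-nonempty pS)))) ⟩
      take (length (spell A)) (spell S)              ≡⟨ cong (take _) (spell-++ A _) ⟩
      take (length (spell A)) (spell A ++ _)         ≡⟨ take-length-++ (spell A) _ ⟩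
      spell A                                        ∎
      where open ≡-Reasoning

  CanonicalDescription⇒InGLPF~ : ∀ {p ℓ} → CanonicalDescription p ℓ → InGLPF~ o p ℓ
  CanonicalDescription⇒InGLPF~ (S , canonical@(pS , inj₁ trivial) , refl , ℓ≡0 , _) with ℓ≡0 trivial
  ... | refl = S , canonical , refl , trivial-GLPF pS trivial
  CanonicalDescription⇒InGLPF~
    (S , canonical@(pS , inj₂ (_ , _ , _ , S≡ , _ , sec′ , _)) , refl , _ , certified)
    with certified (secondary⇒nontrivial S≡ sec′)
  ... | w , X , v , A , B , (_ , _ , _ , _ , sec , _) , rA , rB , S≡A++ , refl =
    S , canonical , refl ,
    subst (IsGLPF o (pos (spell S))) (cong length (sym (IsReprMinus-spell rA)))
          (certificate-GLPF pS S≡A++ (IsReprMinus-spell rA) sec rB)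

module CanonicalOfGlpf (T : Str) (em : EndMarked T) (o : Order) where
  open Text T
  open Occurrences T
  open Paths T
  open EndMarker T em
  open Representatives T
  open Glpf T o

  above-bound-not-smaller : ∀ W X R u Q {ℓ} → LcpBound (W ++ X ++ R) ℓ → ℓ ≡ length W → X ≢ [] →
    T ≡ u ++ (W ++ X ++ Q) → ¬ ((W ++ X ++ Q) ⊏⟨ o ⟩ (W ++ X ++ R))
  above-bound-not-smaller W X R u Q bound refl X≢[] T≡ lt =
    ≤⇒≯ (bound u _ T≡ (++-nonemptyʳ W _ (++-nonemptyˡ X Q X≢[])) lt) (lcp-exceeds W X R Q X≢[])

  tail-IsReprPlus : ∀ {W X v R′ ℓ B} → IsEdge (W , X , v) → LcpBound (W ++ X ++ R′) ℓ → ℓ ≡ length W →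
    Path v sink B → spell B ≡ R′ → IsReprPlus o v B
  tail-IsReprPlus {W} {X} {v} {R′} edge bound ℓ≡|W| pB refl = pB , λ Q pQ →
    let (u , T≡) = Path-target-extends (cons edge pQ) in
    ⊑-cancelˡ o X (⊑-cancelˡ o W (⊑-total o _ _
      (above-bound-not-smaller W X R′ u (spell Q) bound ℓ≡|W| (label≢[] edge) T≡)))

  edge-not-primary : ∀ {W X v R′ ℓ uY Y Yr} → IsEdge (W , X , v) → LcpBound (W ++ X ++ R′) ℓ → ℓ ≡ length W →
    T ≡ uY ++ Y → Y ≢ [] → Y ⊏⟨ o ⟩ (W ++ X ++ R′) → Y ≡ W ++ Yr → ¬ PrimPlus o (W , X , v)
  edge-not-primary {W} {X} {v} {R′} {uY = uY} {Yr = Yr} edge bound ℓ≡|W| T≡ Y≢[] Y⊏ refl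
                   (.(_ ∷ P′) , (pP@(cons _ pP′) , minimal) , P′ , refl)
    with path-to-sink uY Yr (source-Node edge) T≡ Y≢[]
  ... | Q , pQ , refl with Path-target-extends pP
  ... | u , T≡u++ = above-bound-not-smaller W X R′ u (spell P′) bound ℓ≡|W| (label≢[] edge) T≡u++
                      (⊑-⊏-trans o (⊑-++ˡ o W (minimal Q pQ)) Y⊏)

  canonical-at-node : ∀ {u W R ℓ uY Y Yr} → T ≡ u ++ (W ++ R) → R ≢ [] → LcpBound (W ++ R) ℓ → ℓ ≡ length W →
    Node W → T ≡ uY ++ Y → Y ≢ [] → Y ⊏⟨ o ⟩ (W ++ R) → Y ≡ W ++ Yr →
    CanonicalDescription (pos (W ++ R)) ℓ
  canonical-at-node {u} {W} {R} {uY = uY} {Yr = Yr} T≡uZ R≢[] bound ℓ≡|W| nodeW T≡uY Y≢[] Y⊏ Y≡WYr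
    with root-path nodeW
  ... | A , pA , spellA with edge-towards nodeW R≢[] (inj₂ (u , T≡uZ))
  ... | X , R′ , v , refl , edge with edge-shift edge R′
  ... | u₁ , vR′≡ , s with SameEndPos-suffix s (u , T≡uZ)
  ... | a , T≡avR′ with path-to-sink a R′ (target-Node edge) T≡avR′ vR′≢[]
    where
    vR′≢[] : v ++ R′ ≢ []
    vR′≢[] = subst (_≢ []) (sym vR′≡) (++-nonemptyʳ u₁ _ (++-nonemptyʳ W _ (++-nonemptyˡ X R′ (label≢[] edge))))
  ... | B , pB , spellB =
    S , (pS , inj₂ ((W , X , v) , cert)) , cong pos (sym spellS) ,
    (λ trivial → ⊥-elim (secondary⇒nontrivial refl sec trivial)) ,
    (λ _ → W , X , v , A , B , cert , rA , rB , refl , trans ℓ≡|W| (cong length (sym spellA)))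
    where
    rA : IsReprMinus W A
    rA = spell-IsReprMinus pA spellA
    rB : IsReprPlus o v B
    rB = tail-IsReprPlus edge bound ℓ≡|W| pB spellB
    sec : Secondary o (W , X , v)
    sec = edge , edge-not-primary {uY = uY} {Yr = Yr} edge bound ℓ≡|W| T≡uY Y≢[] Y⊏ Y≡WYr
    S : List Edge
    S = A ++ (W , X , v) ∷ B
    pS : Path root sink S
    pS = Path-++ pA (cons edge pB)
    spellS : spell S ≡ W ++ X ++ R′
    spellS = begin
      spell S                    ≡⟨ spell-++ A _ ⟩
      spell A ++ X ++ spell B    ≡⟨ cong₂ (λ a b → a ++ X ++ b) spellA spellB ⟩
      W ++ X ++ R′               ∎
      where open ≡-Reasoning
    cert : CanoCert o S (W , X , v)
    cert = A , B , refl , IsReprMinus⇒All-PrimMinus [] A nil pA rA , sec , IsReprPlus⇒All-PrimPlus o rB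

  LeftMax-take : ∀ {W R ℓ} → ℓ ≡ length W → LeftMax (take ℓ (W ++ R)) → LeftMax W
  LeftMax-take {W} {R} refl = subst LeftMax (take-length-++ W R)

  smaller-suffix⇒CanonicalDescription : ∀ {u Z uY Y ℓ} → T ≡ u ++ Z → Z ≢ [] → LcpBound Z ℓ →
    LeftMax (take ℓ Z) → T ≡ uY ++ Y → Y ≢ [] → Y ⊏⟨ o ⟩ Z → lcp Z Y ≡ ℓ → CanonicalDescription (pos Z) ℓ
  smaller-suffix⇒CanonicalDescription {u} {Z} {uY} {Y} T≡uZ Z≢[] bound lm T≡uY Y≢[] Y⊏Z lcp≡ℓ
    with prefix-trichotomy Z Y
  ... | inj₁ (R₀ , refl) with suffix-occurs-only-at-end (u , T≡uZ) Z≢[] uY R₀ T≡uY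
  ... | refl = ⊥-elim (⊏-irrefl o (subst (_⊏⟨ o ⟩ Z) (++-identityʳ Z) Y⊏Z))
  smaller-suffix⇒CanonicalDescription {u} {Z} {uY} {Y} T≡uZ Z≢[] bound lm T≡uY Y≢[] Y⊏Z lcp≡ℓ
    | inj₂ (inj₁ (R , R≢[] , refl)) =
    canonical-at-node {u = u} {uY = uY} T≡uZ R≢[] bound ℓ≡|Y| (inj₂ (uY , T≡uY) , LeftMax-take ℓ≡|Y| lm)
                      T≡uY Y≢[] Y⊏Z (sym (++-identityʳ Y))
    where
    ℓ≡|Y| : _ ≡ length Y
    ℓ≡|Y| = trans (sym lcp≡ℓ) (lcp-prefix Y R)
  smaller-suffix⇒CanonicalDescription {u} {Z} {uY} {Y} T≡uZ Z≢[] bound lm T≡uY Y≢[] Y⊏Z lcp≡ℓ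
    | inj₂ (inj₂ (P , a , b , Z₁ , Z₂ , a≢b , refl , refl)) =
    canonical-at-node {u = u} {uY = uY} {Yr = b ∷ Z₂} T≡uZ (λ ()) bound ℓ≡|P|
                      (inj₁ branching , LeftMax-take ℓ≡|P| lm) T≡uY Y≢[] Y⊏Z refl
    where
    ℓ≡|P| : _ ≡ length P
    ℓ≡|P| = trans (sym lcp≡ℓ) (lcp-branch P Z₁ Z₂ a≢b)
    branching : RightMax P
    branching = branch⇒RightMax a≢b (suffix-factor (u , T≡uZ)) (suffix-factor (uY , T≡uY))

  no-smaller⇒CanonicalDescription : ∀ {u Z ℓ} → T ≡ u ++ Z → Z ≢ [] →
    (∀ u′ Y → T ≡ u′ ++ Y → Y ≢ [] → ¬ (Y ⊏⟨ o ⟩ Z)) → ℓ ≡ 0 → CanonicalDescription (pos Z) ℓ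
  no-smaller⇒CanonicalDescription {u} {Z} T≡uZ Z≢[] minimal ℓ≡0 with path-to-sink u Z root-Node T≡uZ Z≢[]
  ... | Q , pQ , refl =
    Q , (pQ , inj₁ trivial) , refl , (λ _ → ℓ≡0) , (λ nontrivial → ⊥-elim (nontrivial trivial))
    where
    trivial : Trivial o Q
    trivial = IsReprPlus⇒All-PrimPlus o (pQ , λ Q′ pQ′ →
      let (u′ , T≡) = Path-target-extends pQ′ in
      ⊑-total o _ _ (minimal u′ (spell Q′) T≡ (Path-to-sink-nonempty pQ′)))

  IsGLPF⇒CanonicalDescription : ∀ p ℓ → 1 ≤ p → p ≤ n → IsGLPF o p ℓ → LeftMax (take ℓ (Suf p)) →
    CanonicalDescription p ℓ
  IsGLPF⇒CanonicalDescription p ℓ 1≤p p≤n g lm with Suf-split p 1≤p p≤n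
  ... | u , T≡uZ , Z≢[] = subst (λ k → CanonicalDescription k ℓ) (pos-Suf p 1≤p p≤n)
                                (describe (anyUpTo? (λ i → Suf (suc i) ⊏⟨ o ⟩? Suf p) n))
    where
    describe : Dec (∃[ i ] (i < n × Suf (suc i) ⊏⟨ o ⟩ Suf p)) → CanonicalDescription (pos (Suf p)) ℓ
    describe (no none) = no-smaller⇒CanonicalDescription T≡uZ Z≢[] no-smaller (IsGLPF-zero p g none)
      where
      no-smaller : ∀ u′ Y → T ≡ u′ ++ Y → Y ≢ [] → ¬ (Y ⊏⟨ o ⟩ Suf p)
      no-smaller u′ Y T≡ Y≢[] lt =
        none (length u′ , suffix-start< u′ Y T≡ Y≢[] , subst (_⊏⟨ o ⟩ Suf p) (sym (Suf-suffix u′ Y T≡)) lt)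
    describe (yes smaller) with IsGLPF-witness p g smaller
    ... | q , 1≤q , q≤n , lt , lcp≡ℓ with Suf-split q 1≤q q≤n
    ... | uY , T≡uY , Y≢[] =
      smaller-suffix⇒CanonicalDescription T≡uZ Z≢[] (IsGLPF⇒LcpBound p g) lm T≡uY Y≢[] lt lcp≡ℓ

lemma9 : (T : Str) → EndMarked T → (o : Order) → (p ℓ : ℕ) → 1 ≤ p → p ≤ Text.n T
    → (Text.InGLPF~ T o p ℓ
        ⇔ (Text.IsGLPF T o p ℓ × Text.LeftMax T (take ℓ (Text.Suf T p))))
      × (Text.InGLPF~ T o p ℓ
        ⇔ (∃[ S ] (Text.Canonical T o S × p ≡ Text.pos T (Text.spell T S)
            × (Text.Trivial T o S → ℓ ≡ 0)
            × (¬ Text.Trivial T o S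
               → ∃[ w ] ∃[ X ] ∃[ v ] ∃[ A ] ∃[ B ]
                   (Text.CanoCert T o S (w , X , v)
                   × Text.IsReprMinus T w A × Text.IsReprPlus T o v B
                   × S ≡ A ++ (w , X , v) ∷ B
                   × ℓ ≡ length (Text.spell T A))))))
lemma9 T em o p ℓ 1≤p p≤n = mk⇔ a⇒b (c⇒a ∘′ b⇒c) , mk⇔ (b⇒c ∘′ a⇒b) c⇒a
  where
  open Text T
  open Glpf T o
  open GlpfOfCanonical T em o
  open CanonicalOfGlpf T em o

  a⇒b : InGLPF~ o p ℓ → IsGLPF o p ℓ × LeftMax (take ℓ (Suf p))
  a⇒b = InGLPF~⇒IsGLPF×LeftMax

  b⇒c : IsGLPF o p ℓ × LeftMax (take ℓ (Suf p)) → CanonicalDescription p ℓ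
  b⇒c (g , lm) = IsGLPF⇒CanonicalDescription p ℓ 1≤p p≤n g lm

  c⇒a : CanonicalDescription p ℓ → InGLPF~ o p ℓ
  c⇒a = CanonicalDescription⇒InGLPF~
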